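{- Let $r,s,t$ be real numbers with $\delta=r+s+t-1\neq0$ and $a,b,c$ integers, let $\{V_n\}_{n\ge0}$ be defined by $V_0=a$, $V_1=b$, $V_2=c$ and $V_n=rV_{n-1}+sV_{n-2}+tV_{n-3}$ for $n\ge3$, and let $Q_{v,n}=V_n+V_{n+1}i+V_{n+2}j+V_{n+3}k$ for $n\ge0$ (quaternions with $i^2=j^2=k^2=ijk=-1$). Let $\lambda=(r+s-1)a+(r-1)b-c$ and $$\omega=\lambda+i(\lambda-\delta a)+j(\lambda-\delta(a+b))+k(\lambda-\delta(a+b+c)).$$ Then for every integer $n\ge0$, $$\sum_{l=0}^{n}Q_{v,l}=\frac{1}{\delta}\left(Q_{v,n+2}+(1-r)Q_{v,n+1}+tQ_{v,n}+\omega\right).$$ -}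

module Defs where

open import Level using (Level)
open import Algebra.Bundles using (CommutativeRing)
open import Data.Nat using (ℕ; zero; suc)
open import Data.Integer using (ℤ; +_; -[1+_])
open import Data.Product using (_×_)

-- Everything is developed over an arbitrary commutative ring R of scalars
-- (the paper uses R = ℝ, which is not available in agda-stdlib).
module WithRing {c ℓ : Level} (R : CommutativeRing c ℓ) where
  open CommutativeRing R hiding (zero)
  open import Algebra.Definitions.RawMonoid +-rawMonoid using () renaming (_×_ to _×ᵣ_)

  fromℤ : ℤ → Carrier
  fromℤ (+ n)    = n ×ᵣ 1#
  fromℤ -[1+ n ] = - (suc n ×ᵣ 1#)

  V : (r s t : Carrier) (a b c : ℤ) → ℕ → Carrier
  V r s t a b c zero                = fromℤ a
  V r s t a b c (suc zero)          = fromℤ b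
  V r s t a b c (suc (suc zero))    = fromℤ c
  V r s t a b c (suc (suc (suc n))) =
    r * V r s t a b c (suc (suc n)) + s * V r s t a b c (suc n) + t * V r s t a b c n

  record Quaternion : Set c where
    constructor quat
    field
      re ci cj ck : Carrier
  open Quaternion public

  _≋_ : Quaternion → Quaternion → Set ℓ
  p ≋ q = (re p ≈ re q) × (ci p ≈ ci q) × (cj p ≈ cj q) × (ck p ≈ ck q)

  infixl 6 _⊕_
  _⊕_ : Quaternion → Quaternion → Quaternion
  p ⊕ q = quat (re p + re q) (ci p + ci q) (cj p + cj q) (ck p + ck q)

  _⊗_ : Quaternion → Quaternion → Quaternion
  quat a₁ b₁ c₁ d₁ ⊗ quat a₂ b₂ c₂ d₂ =
    quat (a₁ * a₂ - b₁ * b₂ - c₁ * c₂ - d₁ * d₂)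
         (a₁ * b₂ + b₁ * a₂ + c₁ * d₂ - d₁ * c₂)
         (a₁ * c₂ - b₁ * d₂ + c₁ * a₂ + d₁ * b₂)
         (a₁ * d₂ + b₁ * c₂ - c₁ * b₂ + d₁ * a₂)

  infixl 7 _·_
  _·_ : Carrier → Quaternion → Quaternion
  x · q = quat (x * re q) (x * ci q) (x * cj q) (x * ck q)

  scal : Carrier → Quaternion
  scal x = quat x 0# 0# 0#

  Qv : (r s t : Carrier) (a b c : ℤ) → ℕ → Quaternion
  Qv r s t a b c n =
    quat (V r s t a b c n) (V r s t a b c (suc n))
         (V r s t a b c (suc (suc n))) (V r s t a b c (suc (suc (suc n))))

  sumQv : (r s t : Carrier) (a b c : ℤ) → ℕ → Quaternion
  sumQv r s t a b c zero    = Qv r s t a b c zero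
  sumQv r s t a b c (suc n) = sumQv r s t a b c n ⊕ Qv r s t a b c (suc n)

  δ : (r s t : Carrier) → Carrier
  δ r s t = r + s + t - 1#

  lam : (r s t : Carrier) (a b c : ℤ) → Carrier
  lam r s t a b c = (r + s - 1#) * fromℤ a + (r - 1#) * fromℤ b - fromℤ c

  ω : (r s t : Carrier) (a b c : ℤ) → Quaternion
  ω r s t a b c =
    quat L (L - D * A) (L - D * (A + B)) (L - D * (A + B + C))
    where
      L = lam r s t a b c
      D = δ r s t
      A = fromℤ a
      B = fromℤ b
      C = fromℤ c

module Submission where

-- Write Vₙ for the recurrence, D = δ = r + s + t - 1, and
--   Hₘ = Vₘ₊₂ + (1 - r) Vₘ₊₁ + t Vₘ.
-- Unfolding the recurrence once gives the telescoping identity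
--   Hₘ₊₁ = Hₘ + D Vₘ₊₁,
-- so for every shift k the partial sums xₙ = Σ_{l≤n} Vₗ₊ₖ keep
-- D xₙ - Hₖ₊ₙ constant, equal to the "defect" Kₖ = D Vₖ - Hₖ.  The
-- defects satisfy K₀ = λ and Kₖ₊₁ = Kₖ - D Vₖ, which are exactly the four
-- coordinates of ω.  Multiplying by the inverse of D gives the formula in
-- each of the four coordinates of the quaternion sum.

open import Defs
open import Level using (Level)
open import Algebra.Bundles using (CommutativeRing)
open import Data.Nat as ℕ using (ℕ; zero; suc)
import Data.Nat.Properties as ℕₚ
open import Data.Integer as ℤ using (ℤ; +_; -[1+_]; _⊖_; sign; ∣_∣; _◃_)
import Data.Integer.Properties as ℤₚ
open import Data.Sign as Sign using (Sign)
open import Data.Maybe using (Maybe; just; nothing)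
open import Data.Product using (_,_)
open import Relation.Nullary using (yes; no)
import Relation.Binary.PropositionalEquality as ≡
open import Algebra.Solver.Ring.AlmostCommutativeRing
  using (_-Raw-AlmostCommutative⟶_; fromCommutativeRing)

-- The canonical map ℤ → R into any commutative ring preserves +, *, -
-- and the constants; hence the ring solver can normalise polynomial
-- identities with integer coefficients over R.  (The map is built from the
-- optimised natural multiple n ×′ 1#, for which 1 ×′ 1# is 1# on the nose,
-- so the solver's constant 1 is literally 1#.)
module IntegerCoefficients {c ℓ : Level} (R : CommutativeRing c ℓ) where
  open CommutativeRing R hiding (zero)
  open import Algebra.Definitions.RawMonoid +-rawMonoid using (_×′_)
  open import Algebra.Properties.Semiring.Mult.TCOptimised semiring using (×-homo-+; ×1-homo-*; 1+×)
  open import Algebra.Properties.Ring ring using (-1*x≈-x; -0#≈0#; -‿involutive)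
  open import Algebra.Properties.AbelianGroup +-abelianGroup using (⁻¹-∙-comm)
  open import Algebra.Properties.CommutativeSemigroup +-commutativeSemigroup using (interchange)
  import Algebra.Properties.CommutativeSemigroup *-commutativeSemigroup as *-CS
  open import Relation.Binary.Reasoning.Setoid setoid

  ι : ℕ → Carrier
  ι n = n ×′ 1#

  embed : ℤ → Carrier
  embed (+ n)    = ι n
  embed -[1+ n ] = - ι (suc n)

  cancel-1 : ∀ x y → (1# + x) - (1# + y) ≈ x - y
  cancel-1 x y = begin
    (1# + x) + - (1# + y)   ≈⟨ +-congˡ (⁻¹-∙-comm 1# y) ⟨
    (1# + x) + (- 1# + - y) ≈⟨ interchange 1# x (- 1#) (- y) ⟩
    (1# + - 1#) + (x + - y) ≈⟨ +-congʳ (-‿inverseʳ 1#) ⟩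
    0# + (x + - y)          ≈⟨ +-identityˡ _ ⟩
    x - y                   ∎

  embed-⊖ : ∀ m n → embed (m ⊖ n) ≈ ι m - ι n
  embed-⊖ zero    zero    = sym (trans (+-identityˡ _) -0#≈0#)
  embed-⊖ zero    (suc n) = sym (+-identityˡ _)
  embed-⊖ (suc m) zero    = sym (trans (+-congˡ -0#≈0#) (+-identityʳ _))
  embed-⊖ (suc m) (suc n) = begin
    embed (suc m ⊖ suc n)   ≡⟨ ≡.cong embed (ℤₚ.[1+m]⊖[1+n]≡m⊖n m n) ⟩
    embed (m ⊖ n)           ≈⟨ embed-⊖ m n ⟩
    ι m - ι n               ≈⟨ cancel-1 (ι m) (ι n) ⟨
    (1# + ι m) - (1# + ι n) ≈⟨ +-cong (1+× m 1#) (-‿cong (1+× n 1#)) ⟨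
    ι (suc m) - ι (suc n)   ∎

  embed-+ : ∀ i j → embed (i ℤ.+ j) ≈ embed i + embed j
  embed-+ -[1+ m ] -[1+ n ] = begin
    - ι (suc (suc (m ℕ.+ n))) ≡⟨ ≡.cong (λ k → - ι (suc k)) (ℕₚ.+-suc m n) ⟨
    - ι (suc m ℕ.+ suc n)     ≈⟨ -‿cong (×-homo-+ 1# (suc m) (suc n)) ⟩
    - (ι (suc m) + ι (suc n)) ≈⟨ ⁻¹-∙-comm _ _ ⟨
    - ι (suc m) + - ι (suc n) ∎
  embed-+ -[1+ m ] (+ n)    = trans (embed-⊖ n (suc m)) (+-comm _ _)
  embed-+ (+ m)    -[1+ n ] = embed-⊖ m (suc n)
  embed-+ (+ m)    (+ n)    = ×-homo-+ 1# m n

  sgn : Sign → Carrier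
  sgn Sign.+ = 1#
  sgn Sign.- = - 1#

  sgn-* : ∀ σ τ → sgn (σ Sign.* τ) ≈ sgn σ * sgn τ
  sgn-* Sign.- Sign.- = begin
    1#          ≈⟨ -‿involutive 1# ⟨
    - - 1#      ≈⟨ -1*x≈-x (- 1#) ⟨
    - 1# * - 1# ∎
  sgn-* Sign.- Sign.+ = sym (*-identityʳ _)
  sgn-* Sign.+ Sign.- = sym (*-identityˡ _)
  sgn-* Sign.+ Sign.+ = sym (*-identityˡ _)

  embed-◃ : ∀ σ n → embed (σ ◃ n) ≈ sgn σ * ι n
  embed-◃ σ      zero    = sym (zeroʳ _)
  embed-◃ Sign.+ (suc n) = sym (*-identityˡ _)
  embed-◃ Sign.- (suc n) = sym (-1*x≈-x _)

  embed-sign : ∀ i → embed i ≈ sgn (sign i) * ι ∣ i ∣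
  embed-sign i = trans (reflexive (≡.cong embed (≡.sym (ℤₚ.◃-inverse i))))
                       (embed-◃ (sign i) ∣ i ∣)

  embed-* : ∀ i j → embed (i ℤ.* j) ≈ embed i * embed j
  embed-* i j = begin
    embed (sign i Sign.* sign j ◃ ∣ i ∣ ℕ.* ∣ j ∣)
      ≈⟨ embed-◃ (sign i Sign.* sign j) (∣ i ∣ ℕ.* ∣ j ∣) ⟩
    sgn (sign i Sign.* sign j) * ι (∣ i ∣ ℕ.* ∣ j ∣)
      ≈⟨ *-cong (sgn-* (sign i) (sign j)) (×1-homo-* ∣ i ∣ ∣ j ∣) ⟩
    (sgn (sign i) * sgn (sign j)) * (ι ∣ i ∣ * ι ∣ j ∣)
      ≈⟨ *-CS.interchange _ _ _ _ ⟩
    (sgn (sign i) * ι ∣ i ∣) * (sgn (sign j) * ι ∣ j ∣)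
      ≈⟨ *-cong (embed-sign i) (embed-sign j) ⟨
    embed i * embed j ∎

  embed-neg : ∀ i → embed (ℤ.- i) ≈ - embed i
  embed-neg (+ zero)  = sym -0#≈0#
  embed-neg (+ suc n) = refl
  embed-neg -[1+ n ]  = sym (-‿involutive _)

  embed-hom : ℤ.+-*-rawRing -Raw-AlmostCommutative⟶ fromCommutativeRing R
  embed-hom = record
    { ⟦_⟧ = embed ; +-homo = embed-+ ; *-homo = embed-* ; -‿homo = embed-neg
    ; 0-homo = refl ; 1-homo = refl }

  _≟-coeff_ : ∀ i j → Maybe (embed i ≈ embed j)
  i ≟-coeff j with i ℤ.≟ j
  ... | yes ≡.refl = just refl
  ... | no _       = nothing

  open import Algebra.Solver.Ring ℤ.+-*-rawRing (fromCommutativeRing R) embed-hom _≟-coeff_ public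

  :1 : ∀ {n} → Polynomial n
  :1 = con (+ 1)

module Telescoping {c ℓ : Level} (R : CommutativeRing c ℓ) where
  open CommutativeRing R hiding (zero)
  open IntegerCoefficients R using (solve; _:+_; _:*_; _:-_; _:=_)
  open import Relation.Binary.Reasoning.Setoid setoid

  telescope : (d : Carrier) (x v h : ℕ → Carrier)
    → (∀ n → x (suc n) ≈ x n + v (suc n))
    → (∀ n → h (suc n) ≈ h n + d * v (suc n))
    → ∀ n → d * x n - h n ≈ d * x 0 - h 0
  telescope d x v h x-step h-step zero    = refl
  telescope d x v h x-step h-step (suc n) = begin
    d * x (suc n) - h (suc n)
      ≈⟨ +-cong (*-congˡ (x-step n)) (-‿cong (h-step n)) ⟩
    d * (x n + v (suc n)) - (h n + d * v (suc n))
      ≈⟨ increments-cancel d (x n) (v (suc n)) (h n) ⟩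
    d * x n - h n
      ≈⟨ telescope d x v h x-step h-step n ⟩
    d * x 0 - h 0 ∎
    where
    increments-cancel : ∀ d x v h → d * (x + v) - (h + d * v) ≈ d * x - h
    increments-cancel = solve 4 (λ d x v h → d :* (x :+ v) :- (h :+ d :* v) := d :* x :- h) refl

  divide : ∀ {d e y z} → d * e ≈ 1# → d * y ≈ z → y ≈ e * z
  divide {d} {e} {y} {z} de≈1 dy≈z = begin
    y             ≈⟨ *-identityˡ y ⟨
    1# * y        ≈⟨ *-congʳ (trans (*-comm e d) de≈1) ⟨
    (e * d) * y   ≈⟨ *-assoc e d y ⟩
    e * (d * y)   ≈⟨ *-congˡ dy≈z ⟩
    e * z         ∎

module Recurrence {c ℓ : Level} (R : CommutativeRing c ℓ)
                  (r s t : CommutativeRing.Carrier R) (a b c : ℤ) where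
  open CommutativeRing R hiding (zero)
  open WithRing R
  open IntegerCoefficients R using (solve; _:+_; _:*_; _:-_; _:=_; :1)
  open Telescoping R

  Vₙ : ℕ → Carrier
  Vₙ = V r s t a b c

  D : Carrier
  D = δ r s t

  H : ℕ → Carrier
  H m = Vₙ (suc (suc m)) + (1# - r) * Vₙ (suc m) + t * Vₙ m

  H-step : ∀ m → H (suc m) ≈ H m + D * Vₙ (suc m)
  H-step m = shift r s t (Vₙ m) (Vₙ (suc m)) (Vₙ (suc (suc m)))
    where
    shift : ∀ r s t x y z →
      (r * z + s * y + t * x) + (1# - r) * z + t * y
        ≈ (z + (1# - r) * y + t * x) + (r + s + t - 1#) * y
    shift = solve 6 (λ r s t x y z →
      (r :* z :+ s :* y :+ t :* x) :+ (:1 :- r) :* z :+ t :* y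
        := (z :+ (:1 :- r) :* y :+ t :* x) :+ (r :+ s :+ t :- :1) :* y) refl

  -- the defect Kₖ = D Vₖ - Hₖ, the constant left over when summing from index k
  K : ℕ → Carrier
  K k = D * Vₙ k - H k

  K-zero : K 0 ≈ lam r s t a b c
  K-zero = initial r s t (fromℤ a) (fromℤ b) (fromℤ c)
    where
    initial : ∀ r s t A B C →
      (r + s + t - 1#) * A - (C + (1# - r) * B + t * A)
        ≈ (r + s - 1#) * A + (r - 1#) * B - C
    initial = solve 6 (λ r s t A B C →
      (r :+ s :+ t :- :1) :* A :- (C :+ (:1 :- r) :* B :+ t :* A)
        := (r :+ s :- :1) :* A :+ (r :- :1) :* B :- C) refl

  K-suc : ∀ k → K (suc k) ≈ K k - D * Vₙ k
  K-suc k = trans (+-congˡ (-‿cong (H-step k))) (drop-increment D (Vₙ k) (Vₙ (suc k)) (H k))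
    where
    drop-increment : ∀ d u v h → d * v - (h + d * v) ≈ (d * u - h) - d * u
    drop-increment = solve 4 (λ d u v h →
      d :* v :- (h :+ d :* v) := (d :* u :- h) :- d :* u) refl

  sub-sub : ∀ p q u → (p - D * q) - D * u ≈ p - D * (q + u)
  sub-sub = solve 4 (λ d p q u → (p :- d :* q) :- d :* u := p :- d :* (q :+ u)) refl D

  defects≋ω : quat (K 0) (K 1) (K 2) (K 3) ≋ ω r s t a b c
  defects≋ω = K-zero , K-one , K-two , K-three
    where
    A B C : Carrier
    A = fromℤ a
    B = fromℤ b
    C = fromℤ c
    K-one   : K 1 ≈ lam r s t a b c - D * A
    K-two   : K 2 ≈ lam r s t a b c - D * (A + B)
    K-three : K 3 ≈ lam r s t a b c - D * (A + B + C)
    K-one   = trans (K-suc 0) (+-congʳ K-zero)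
    K-two   = trans (K-suc 1) (trans (+-congʳ K-one) (sub-sub _ _ _))
    K-three = trans (K-suc 2) (trans (+-congʳ K-two) (sub-sub _ _ _))

  -- closed form of Σ_{l ≤ n} V_{k+l}, given as any x with those increments
  -- whose defect D x₀ - Hₖ is w
  shifted-sum : ∀ {δ⁻¹} → D * δ⁻¹ ≈ 1# → (k : ℕ) (x : ℕ → Carrier)
    → (∀ n → x (suc n) ≈ x n + Vₙ (k ℕ.+ suc n))
    → ∀ {w} → D * x 0 - H (k ℕ.+ 0) ≈ w
    → ∀ n → x n ≈ δ⁻¹ * (H (k ℕ.+ n) + w)
  shifted-sum D-inv k x x-step {w} defect n = divide D-inv (begin
    D * x n                 ≈⟨ +-identityʳ _ ⟨
    D * x n + 0#            ≈⟨ +-congˡ (-‿inverseˡ _) ⟨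
    D * x n + (- h n + h n) ≈⟨ +-assoc _ _ _ ⟨
    (D * x n - h n) + h n   ≈⟨ +-comm _ _ ⟩
    h n + (D * x n - h n)   ≈⟨ +-congˡ (telescope D x v h x-step h-step n) ⟩
    h n + (D * x 0 - h 0)   ≈⟨ +-congˡ defect ⟩
    h n + w                 ∎)
    where
    open import Relation.Binary.Reasoning.Setoid setoid
    v h : ℕ → Carrier
    v l = Vₙ (k ℕ.+ l)
    h m = H (k ℕ.+ m)
    h-step : ∀ m → h (suc m) ≈ h m + D * v (suc m)
    h-step m rewrite ℕₚ.+-suc k m = H-step (k ℕ.+ m)

-- Each coordinate of Σ_{l ≤ n} Q_{v,l} is a shifted sum of V (shift 0, 1,
-- 2, 3), whose defect is the matching coordinate of ω.
mainTheorem5 : {ℓc ℓ : Level} (R : CommutativeRing ℓc ℓ)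
    → (r s t : CommutativeRing.Carrier R) (a b c : ℤ)
    → (δ⁻¹ : CommutativeRing.Carrier R)
    → CommutativeRing._≈_ R (CommutativeRing._*_ R (WithRing.δ R r s t) δ⁻¹) (CommutativeRing.1# R)
    → (n : ℕ)
    → WithRing._≋_ R
        (WithRing.sumQv R r s t a b c n)
        (WithRing._·_ R δ⁻¹
          (WithRing._⊕_ R
            (WithRing._⊕_ R
              (WithRing._⊕_ R
                (WithRing.Qv R r s t a b c (suc (suc n)))
                (WithRing._·_ R (CommutativeRing._-_ R (CommutativeRing.1# R) r) (WithRing.Qv R r s t a b c (suc n))))
              (WithRing._·_ R t (WithRing.Qv R r s t a b c n)))
            (WithRing.ω R r s t a b c)))
mainTheorem5 R r s t a b c δ⁻¹ D-inv n =
  let (K₀≈ω₀ , K₁≈ω₁ , K₂≈ω₂ , K₃≈ω₃) = defects≋ω in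
    shifted-sum D-inv 0 (λ m → re (sumQv r s t a b c m)) (λ _ → refl) K₀≈ω₀ n
  , shifted-sum D-inv 1 (λ m → ci (sumQv r s t a b c m)) (λ _ → refl) K₁≈ω₁ n
  , shifted-sum D-inv 2 (λ m → cj (sumQv r s t a b c m)) (λ _ → refl) K₂≈ω₂ n
  , shifted-sum D-inv 3 (λ m → ck (sumQv r s t a b c m)) (λ _ → refl) K₃≈ω₃ n
  where
  open CommutativeRing R using (refl)
  open WithRing R
  open Recurrence R r s t a b c
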